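{- Let $n\geq 3$ and $0<k\leq n/2$ be integers. The accordion graph $A[n,k]$ is isomorphic to the circulant graph (i) $\mathrm{Ci}[2n,\{2,k\}]$ when $k$ is odd; (ii) $\mathrm{Ci}[2n,\{2,n-k\}]$ when $n$ is odd and $k$ is even; and (iii) $\mathrm{Ci}[2n,\{1,n-1\}]$ when $n$ is even and $k=2$.
   Context: The accordion graph $A[n,k]$ has vertex set $\{u_1,\dots,u_n,v_1,\dots,v_n\}$ and edge set $\{u_iu_{i+1}, v_iv_{i+1}, u_iv_i, u_iv_{i+k} : i\in\{1,\dots,n\}\}$, indices modulo $n$. For a positive integer $m$ and a set $S$ of positive integers less than $m$, the circulant graph $\mathrm{Ci}[m,S]$ has vertices $x_1,\dots,x_m$, with $x_i$ adjacent to $x_{i+s}$ and $x_{i-s}$ for every $s\in S$ (indices taken modulo $m$). -}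

module Defs where

open import Data.Nat using (ℕ; _+_; _*_; _∸_; _<_; _≤_)
open import Data.Fin using (Fin; toℕ)
open import Data.Sum using (_⊎_; inj₁; inj₂)
open import Data.Product using (_×_; ∃-syntax)
open import Data.Empty using (⊥)
open import Level using (0ℓ)
open import Relation.Binary.PropositionalEquality using (_≡_)
open import Function.Bundles using (_⤖_; Bijection)

_≡_[mod_] : ℕ → ℕ → ℕ → Set
a ≡ b [mod m ] = (∃[ q ] a ≡ b + q * m) ⊎ (∃[ q ] b ≡ a + q * m)

record Graph : Set₁ where
  field
    V   : Set
    Adj : V → V → Set
open Graph public

record _≅_ (G H : Graph) : Set where
  field
    bij      : V G ⤖ V H
  f : V G → V H
  f = Bijection.to bij
  field
    preserves : ∀ x y → Adj G x y → Adj H (f x) (f y)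
    reflects  : ∀ x y → Adj H (f x) (f y) → Adj G x y

-- Vertices of the accordion graph A[n,k]:  u i = inj₁ i,  v i = inj₂ i,
-- with indices i ∈ {0,…,n-1} (the paper's index n corresponds to 0).
AccV : ℕ → Set
AccV n = Fin n ⊎ Fin n

data AccEdge (n k : ℕ) : AccV n → AccV n → Set where
  uu : ∀ i j → toℕ j ≡ toℕ i + 1 [mod n ] → AccEdge n k (inj₁ i) (inj₁ j)
  vv : ∀ i j → toℕ j ≡ toℕ i + 1 [mod n ] → AccEdge n k (inj₂ i) (inj₂ j)
  uv : ∀ i j → toℕ j ≡ toℕ i [mod n ]     → AccEdge n k (inj₁ i) (inj₂ j)
  uvk : ∀ i j → toℕ j ≡ toℕ i + k [mod n ] → AccEdge n k (inj₁ i) (inj₂ j)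

Accordion : ℕ → ℕ → Graph
Accordion n k = record
  { V   = AccV n
  ; Adj = λ x y → AccEdge n k x y ⊎ AccEdge n k y x }

Circulant : (m : ℕ) → (S : ℕ → Set) → Graph
Circulant m S = record
  { V   = Fin m
  ; Adj = λ x y → ∃[ s ] (S s × (toℕ y ≡ toℕ x + s [mod m ] ⊎ toℕ x ≡ toℕ y + s [mod m ])) }

｛_,_｝ : ℕ → ℕ → ℕ → Set
｛ a , b ｝ s = s ≡ a ⊎ s ≡ b

Odd Even : ℕ → Set
Even n = ∃[ q ] n ≡ 2 * q
Odd n = ∃[ q ] n ≡ 1 + 2 * q

-- For (i) and (ii) send u_i ↦ 2i and v_j ↦ 2j + c (mod 2n) with c odd, and let t be odd. The two
-- n-cycles go to the even and the odd residues, joined by the steps ±2, while an odd step ±t can only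
-- join residues of different parity. A rung u_i v_j (j ≡ i or j ≡ i + k mod n) becomes the step
-- 2j + c − 2i ∈ {c, c + 2k}, so the map is an isomorphism onto Ci[2n,{2,t}] as soon as
-- {c, c + 2k} ≡ {t, −t} (mod 2n). In (i) take t = k and c ≡ −k; in (ii) take t = c = n − k, where
-- c + 2k + t = 2n. For (iii) send u_i ↦ i and v_j ↦ n + (j − 1 mod n): as n + 1 ≡ −(n − 1) (mod 2n),
-- Ci[2n,{1,n−1}] joins exactly the positions differing by ±1 modulo n, which are the edges of A[n,2].
module Submission where

open import Defs
open import Data.Nat
open import Data.Nat.Properties
open import Data.Nat.DivMod using (_mod_; m≡m%n+[m/n]*n; m%n<n; [m+kn]%n≡m%n; m<n⇒m%n≡m)
open import Data.Nat.Tactic.RingSolver using (solve; solve-∀)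
open import Data.Fin as Fin using (Fin; toℕ)
open import Data.Fin.Patterns using (0F; 1F)
open import Data.Fin.Properties using (toℕ-fromℕ<; toℕ-injective; toℕ<n; toℕ-combine; toℕ-cast; toℕ-↑ˡ; toℕ-↑ʳ; *↔×; +↔⊎)
open import Data.Fin.Permutation using (cast-id)
open import Data.List using (_∷_; [])
open import Data.Product using (_×_; _,_; ∃₂)
open import Data.Sum using (_⊎_; inj₁; inj₂; [_,_]′; swap) renaming (map to ⊎-map)
open import Data.Sum.Function.Propositional using (_⊎-⇔_; _⊎-↔_)
open import Data.Empty using (⊥-elim)
open import Function using (_∘_)
open import Function.Bundles using (_⇔_; _↔_; mk⇔; mk↔ₛ′; Inverse; Equivalence)
open import Function.Construct.Composition using (_⇔-∘_; _↔-∘_)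
open import Function.Construct.Symmetry using (⇔-sym; ↔-sym)
open import Function.Construct.Identity using (↔-id; ⇔-id)
open import Function.Properties.Inverse using (↔⇒⤖)
open import Relation.Nullary using (¬_)
open import Relation.Binary.Structures using (IsEquivalence)
open import Relation.Binary.Bundles using (Setoid)
open import Relation.Binary.PropositionalEquality using (_≡_; refl; sym; trans; cong; cong₂; module ≡-Reasoning)
import Relation.Binary.Reasoning.Setoid as SetoidReasoning

open Equivalence using (to; from)

even⊎odd : ∀ z → Even z ⊎ Odd z
even⊎odd zero = inj₁ (0 , refl)
even⊎odd (suc z) with even⊎odd z
... | inj₁ (q , z≡2q)   = inj₂ (q , cong suc z≡2q)
... | inj₂ (q , z≡1+2q) = inj₁ (suc q , trans (cong suc z≡1+2q) (solve (q ∷ [])))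

odd∸even : ∀ {n k} → Odd n → Even k → k ≤ n → Odd (n ∸ k)
odd∸even {n} {k} (a , n≡1+2a) (b , k≡2b) k≤n with even⊎odd (n ∸ k)
... | inj₂ n∸k-odd = n∸k-odd
... | inj₁ (q , n∸k≡2q) = ⊥-elim (even≢odd (b + q) a (begin
  2 * (b + q)        ≡⟨ *-distribˡ-+ 2 b q ⟩
  2 * b + 2 * q      ≡⟨ cong₂ _+_ k≡2b n∸k≡2q ⟨
  k + (n ∸ k)        ≡⟨ m+[n∸m]≡n k≤n ⟩
  n                  ≡⟨ n≡1+2a ⟩
  1 + 2 * a          ∎))
  where open ≡-Reasoning

-- Unlike _≡_[mod_] a single equation, so transitivity and addition need no case split.
infix 4 _≋_[mod_]

_≋_[mod_] : ℕ → ℕ → ℕ → Set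
a ≋ b [mod m ] = ∃₂ λ x y → a + x * m ≡ b + y * m

module _ {m : ℕ} where

  ≋-refl : ∀ {a} → a ≋ a [mod m ]
  ≋-refl = 0 , 0 , refl

  ≋-reflexive : ∀ {a b} → a ≡ b → a ≋ b [mod m ]
  ≋-reflexive refl = ≋-refl

  ≋-sym : ∀ {a b} → a ≋ b [mod m ] → b ≋ a [mod m ]
  ≋-sym (x , y , e) = y , x , sym e

  ≋-trans : ∀ {a b c} → a ≋ b [mod m ] → b ≋ c [mod m ] → a ≋ c [mod m ]
  ≋-trans {a} {b} {c} (x , y , e) (x′ , y′ , e′) = x + x′ , y′ + y , (begin
    a + (x + x′) * m      ≡⟨ solve (a ∷ x ∷ x′ ∷ m ∷ []) ⟩
    (a + x * m) + x′ * m  ≡⟨ cong (_+ x′ * m) e ⟩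
    (b + y * m) + x′ * m  ≡⟨ solve (b ∷ y ∷ x′ ∷ m ∷ []) ⟩
    (b + x′ * m) + y * m  ≡⟨ cong (_+ y * m) e′ ⟩
    (c + y′ * m) + y * m  ≡⟨ solve (c ∷ y′ ∷ y ∷ m ∷ []) ⟩
    c + (y′ + y) * m      ∎)
    where open ≡-Reasoning

  ≋-isEquivalence : IsEquivalence (_≋_[mod m ])
  ≋-isEquivalence = record { refl = ≋-refl ; sym = ≋-sym ; trans = ≋-trans }

  +-cong-mod : ∀ {a b c d} → a ≋ b [mod m ] → c ≋ d [mod m ] → a + c ≋ b + d [mod m ]
  +-cong-mod {a} {b} {c} {d} (x , y , e) (x′ , y′ , e′) = x + x′ , y + y′ , (begin
    a + c + (x + x′) * m        ≡⟨ solve (a ∷ c ∷ x ∷ x′ ∷ m ∷ []) ⟩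
    (a + x * m) + (c + x′ * m)  ≡⟨ cong₂ _+_ e e′ ⟩
    (b + y * m) + (d + y′ * m)  ≡⟨ solve (b ∷ d ∷ y ∷ y′ ∷ m ∷ []) ⟩
    b + d + (y + y′) * m        ∎)
    where open ≡-Reasoning

  +-cancelʳ-mod : ∀ {a b} c → a + c ≋ b + c [mod m ] → a ≋ b [mod m ]
  +-cancelʳ-mod {a} {b} c (x , y , e) = x , y , +-cancelʳ-≡ c _ _ (begin
    a + x * m + c  ≡⟨ solve (a ∷ x ∷ m ∷ c ∷ []) ⟩
    a + c + x * m  ≡⟨ e ⟩
    b + c + y * m  ≡⟨ solve (b ∷ c ∷ y ∷ m ∷ []) ⟩
    b + y * m + c  ∎)
    where open ≡-Reasoning

  multiple⇒≋0 : ∀ {a} q → a ≡ q * m → a ≋ 0 [mod m ]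
  multiple⇒≋0 {a} q a≡qm = 0 , q , trans (+-identityʳ a) a≡qm

  modulus≋0 : m ≋ 0 [mod m ]
  modulus≋0 = multiple⇒≋0 1 (sym (*-identityˡ m))

  ≋⇒≡[mod] : ∀ {a b} → a ≋ b [mod m ] → a ≡ b [mod m ]
  ≋⇒≡[mod] {a} {b} (x , y , e) with ≤-total x y
  ... | inj₁ x≤y with d , refl ← m≤n⇒∃[o]m+o≡n x≤y =
    inj₁ (d , +-cancelʳ-≡ (x * m) _ _ (trans e (solve (b ∷ x ∷ d ∷ m ∷ []))))
  ... | inj₂ y≤x with d , refl ← m≤n⇒∃[o]m+o≡n y≤x =
    inj₂ (d , +-cancelʳ-≡ (y * m) _ _ (trans (sym e) (solve (a ∷ y ∷ d ∷ m ∷ []))))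

  ≡[mod]⇒≋ : ∀ {a b} → a ≡ b [mod m ] → a ≋ b [mod m ]
  ≡[mod]⇒≋ {a} (inj₁ (q , e)) = 0 , q , trans (+-identityʳ a) e
  ≡[mod]⇒≋ {b = b} (inj₂ (q , e)) = q , 0 , trans (sym e) (sym (+-identityʳ b))

  module _ .{{_ : NonZero m}} where

    %-≋ : ∀ a → a % m ≋ a [mod m ]
    %-≋ a = a / m , 0 , trans (sym (m≡m%n+[m/n]*n a m)) (sym (+-identityʳ a))

    ≋-<⇒≡ : ∀ {a b} → a ≋ b [mod m ] → a < m → b < m → a ≡ b
    ≋-<⇒≡ {a} {b} (x , y , e) a<m b<m = begin
      a                ≡⟨ m<n⇒m%n≡m a<m ⟨
      a % m            ≡⟨ [m+kn]%n≡m%n a x m ⟨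
      (a + x * m) % m  ≡⟨ cong (_% m) e ⟩
      (b + y * m) % m  ≡⟨ [m+kn]%n≡m%n b y m ⟩
      b % m            ≡⟨ m<n⇒m%n≡m b<m ⟩
      b                ∎
      where open ≡-Reasoning

≋-setoid : ℕ → Setoid _ _
≋-setoid m = record { isEquivalence = ≋-isEquivalence {m} }

module ≋-Reasoning (m : ℕ) = SetoidReasoning (≋-setoid m)

shift-opposite : ∀ {m a b s s′} → s + s′ ≋ 0 [mod m ] → b ≋ a + s [mod m ] → a ≋ b + s′ [mod m ]
shift-opposite {m} {a} {b} {s} {s′} s+s′≋0 b≋a+s = ≋-sym (begin
  b + s′        ≈⟨ +-cong-mod b≋a+s ≋-refl ⟩
  a + s + s′    ≡⟨ +-assoc a s s′ ⟩
  a + (s + s′)  ≈⟨ +-cong-mod ≋-refl s+s′≋0 ⟩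
  a + 0         ≡⟨ +-identityʳ a ⟩
  a             ∎)
  where open ≋-Reasoning m

module _ {n : ℕ} where

  double⇔ : ∀ {a b} → a ≋ b [mod n ] ⇔ 2 * a ≋ 2 * b [mod 2 * n ]
  double⇔ {a} {b} = mk⇔ double halve
    where
    double : a ≋ b [mod n ] → 2 * a ≋ 2 * b [mod 2 * n ]
    double (x , y , e) = x , y , (begin
      2 * a + x * (2 * n)  ≡⟨ solve (a ∷ x ∷ n ∷ []) ⟩
      2 * (a + x * n)      ≡⟨ cong (2 *_) e ⟩
      2 * (b + y * n)      ≡⟨ solve (b ∷ y ∷ n ∷ []) ⟩
      2 * b + y * (2 * n)  ∎)
      where open ≡-Reasoning
    halve : 2 * a ≋ 2 * b [mod 2 * n ] → a ≋ b [mod n ]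
    halve (x , y , e) = x , y , *-cancelˡ-≡ _ _ 2 (begin
      2 * (a + x * n)      ≡⟨ solve (a ∷ x ∷ n ∷ []) ⟩
      2 * a + x * (2 * n)  ≡⟨ e ⟩
      2 * b + y * (2 * n)  ≡⟨ solve (b ∷ y ∷ n ∷ []) ⟩
      2 * (b + y * n)      ∎)
      where open ≡-Reasoning

  double+⇔ : ∀ {a b} s → b ≋ a + s [mod n ] ⇔ 2 * b ≋ 2 * a + 2 * s [mod 2 * n ]
  double+⇔ {a} s = mk⇔
    (λ p → ≋-trans (to double⇔ p) (≋-reflexive (*-distribˡ-+ 2 a s)))
    (λ p → from double⇔ (≋-trans p (≋-reflexive (sym (*-distribˡ-+ 2 a s)))))

  even≉even+odd : ∀ {a b c} → Odd c → ¬ 2 * a ≋ 2 * b + c [mod 2 * n ]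
  even≉even+odd {a} {b} (q , refl) (x , y , e) = even≢odd (a + x * n) (b + q + y * n) (begin
    2 * (a + x * n)              ≡⟨ solve (a ∷ x ∷ n ∷ []) ⟩
    2 * a + x * (2 * n)          ≡⟨ e ⟩
    2 * b + (1 + 2 * q) + y * (2 * n)  ≡⟨ solve (b ∷ q ∷ y ∷ n ∷ []) ⟩
    suc (2 * (b + q + y * n))    ∎)
    where open ≡-Reasoning

  mod-2*⇒mod : ∀ {a b} → a ≋ b [mod 2 * n ] → a ≋ b [mod n ]
  mod-2*⇒mod {a} {b} (x , y , e) = x * 2 , y * 2 , (begin
    a + x * 2 * n    ≡⟨ solve (a ∷ x ∷ n ∷ []) ⟩
    a + x * (2 * n)  ≡⟨ e ⟩
    b + y * (2 * n)  ≡⟨ solve (b ∷ y ∷ n ∷ []) ⟩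
    b + y * 2 * n    ∎)
    where open ≡-Reasoning

  mod⇒mod-2* : ∀ {a b} → a ≋ b [mod n ] → a ≋ b [mod 2 * n ] ⊎ a ≋ b + n [mod 2 * n ]
  mod⇒mod-2* {a} {b} (x , y , e) = by-parity (even⊎odd (x + y))
    where
    open ≡-Reasoning
    a+2xn≡b+[x+y]n : a + x * (2 * n) ≡ b + (x + y) * n
    a+2xn≡b+[x+y]n = begin
      a + x * (2 * n)    ≡⟨ solve (a ∷ x ∷ n ∷ []) ⟩
      a + x * n + x * n  ≡⟨ cong (_+ x * n) e ⟩
      b + y * n + x * n  ≡⟨ solve (b ∷ x ∷ y ∷ n ∷ []) ⟩
      b + (x + y) * n    ∎
    by-parity : Even (x + y) ⊎ Odd (x + y) → a ≋ b [mod 2 * n ] ⊎ a ≋ b + n [mod 2 * n ]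
    by-parity (inj₁ (q , x+y≡2q)) = inj₁ (x , q , (begin
      a + x * (2 * n)  ≡⟨ a+2xn≡b+[x+y]n ⟩
      b + (x + y) * n  ≡⟨ cong (λ z → b + z * n) x+y≡2q ⟩
      b + 2 * q * n    ≡⟨ solve (b ∷ q ∷ n ∷ []) ⟩
      b + q * (2 * n)  ∎))
    by-parity (inj₂ (q , x+y≡1+2q)) = inj₂ (x , q , (begin
      a + x * (2 * n)      ≡⟨ a+2xn≡b+[x+y]n ⟩
      b + (x + y) * n      ≡⟨ cong (λ z → b + z * n) x+y≡1+2q ⟩
      b + (1 + 2 * q) * n  ≡⟨ solve (b ∷ q ∷ n ∷ []) ⟩
      b + n + q * (2 * n)  ∎))

DifferBy : ℕ → ℕ → ℕ → ℕ → Set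
DifferBy m s a b = b ≋ a + s [mod m ] ⊎ a ≋ b + s [mod m ]

module _ {m s : ℕ} where

  differBy-sym : ∀ {a b} → DifferBy m s a b → DifferBy m s b a
  differBy-sym = swap

  differBy-resp : ∀ {a a′ b b′} → a ≋ a′ [mod m ] → b ≋ b′ [mod m ] →
    DifferBy m s a b → DifferBy m s a′ b′
  differBy-resp a≋a′ b≋b′ = ⊎-map (shifted b≋b′ a≋a′) (shifted a≋a′ b≋b′)
    where
    shifted : ∀ {a a′ b b′} → a ≋ a′ [mod m ] → b ≋ b′ [mod m ] →
      a ≋ b + s [mod m ] → a′ ≋ b′ + s [mod m ]
    shifted a≋a′ b≋b′ a≋b+s = ≋-trans (≋-sym a≋a′) (≋-trans a≋b+s (+-cong-mod b≋b′ ≋-refl))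

  differBy-+ʳ⇔ : ∀ {a b} c → DifferBy m s (a + c) (b + c) ⇔ DifferBy m s a b
  differBy-+ʳ⇔ c = cancel ⊎-⇔ cancel
    where
    cancel : ∀ {a b} → b + c ≋ a + c + s [mod m ] ⇔ b ≋ a + s [mod m ]
    cancel {a} {b} = mk⇔
      (λ p → +-cancelʳ-mod c (≋-trans p (≋-reflexive (+-comm-middle a c s))))
      (λ p → ≋-trans (+-cong-mod p ≋-refl) (≋-reflexive (sym (+-comm-middle a c s))))
      where
      +-comm-middle : ∀ a c s → a + c + s ≡ a + s + c
      +-comm-middle = solve-∀

differBy-double⇔ : ∀ {n s a b} → DifferBy n s a b ⇔ DifferBy (2 * n) (2 * s) (2 * a) (2 * b)
differBy-double⇔ {s = s} = double+⇔ s ⊎-⇔ double+⇔ s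

module _ {n t : ℕ} where

  differBy-1⇔doubled-steps : Odd t → ∀ {a b} →
    DifferBy n 1 a b ⇔ (DifferBy (2 * n) 2 (2 * a) (2 * b) ⊎ DifferBy (2 * n) t (2 * a) (2 * b))
  differBy-1⇔doubled-steps t-odd {a} {b} = mk⇔ (inj₁ ∘ to doubled) [ from doubled , ⊥-elim ∘ no-odd-step ]′
    where
    doubled : DifferBy n 1 a b ⇔ DifferBy (2 * n) 2 (2 * a) (2 * b)
    doubled = differBy-double⇔
    no-odd-step : ¬ DifferBy (2 * n) t (2 * a) (2 * b)
    no-odd-step (inj₁ p) = even≉even+odd {n} {b} {a} t-odd p
    no-odd-step (inj₂ p) = even≉even+odd {n} {a} {b} t-odd p

¬differBy-2-even-odd : ∀ {n c a b} → Odd c → ¬ DifferBy (2 * n) 2 (2 * a) (2 * b + c)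
¬differBy-2-even-odd {n} {c} {a} {b} c-odd (inj₁ 2b+c≋2a+2) =
  even≉even+odd {n} {a + 1} {b} c-odd (≋-trans (≋-reflexive (*-distribˡ-+ 2 a 1)) (≋-sym 2b+c≋2a+2))
¬differBy-2-even-odd {n} {c} {a} {b} c-odd (inj₂ 2a≋2b+c+2) =
  even≉even+odd {n} {a} {b + 1} c-odd (≋-trans 2a≋2b+c+2 (≋-reflexive (reassoc b c)))
  where
  reassoc : ∀ b c → 2 * b + c + 2 ≡ 2 * (b + 1) + c
  reassoc = solve-∀

-- {c, c + d} = {t, −t} modulo m.
PlusMinusPair : ℕ → ℕ → ℕ → ℕ → Set
PlusMinusPair m t c d = (c ≋ t [mod m ] × c + d + t ≋ 0 [mod m ]) ⊎ (c + t ≋ 0 [mod m ] × c + d ≋ t [mod m ])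

plusMinus-differBy⇔ : ∀ {m t c d x y} → PlusMinusPair m t c d →
  (x ≋ y [mod m ] ⊎ x ≋ y + d [mod m ]) ⇔ DifferBy m t y (x + c)
plusMinus-differBy⇔ {m} {t} {c} {d} {x} {y} (inj₁ (c≋t , c+d+t≋0)) = mk⇔ to′ from′
  where
  open ≋-Reasoning m
  to′ : x ≋ y [mod m ] ⊎ x ≋ y + d [mod m ] → DifferBy m t y (x + c)
  to′ (inj₁ x≋y) = inj₁ (+-cong-mod x≋y c≋t)
  to′ (inj₂ x≋y+d) = inj₂ (begin
    y            ≈⟨ shift-opposite d+[c+t]≋0 x≋y+d ⟩
    x + (c + t)  ≡⟨ +-assoc x c t ⟨
    x + c + t    ∎)
    where
    d+[c+t]≋0 : d + (c + t) ≋ 0 [mod m ]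
    d+[c+t]≋0 = begin d + (c + t) ≡⟨ solve (c ∷ d ∷ t ∷ []) ⟩ c + d + t ≈⟨ c+d+t≋0 ⟩ 0 ∎
  from′ : DifferBy m t y (x + c) → x ≋ y [mod m ] ⊎ x ≋ y + d [mod m ]
  from′ (inj₁ x+c≋y+t) = inj₁ (+-cancelʳ-mod c (≋-trans x+c≋y+t (+-cong-mod ≋-refl (≋-sym c≋t))))
  from′ (inj₂ y≋x+c+t) = inj₂ (shift-opposite c+t+d≋0 (≋-trans y≋x+c+t (≋-reflexive (+-assoc x c t))))
    where
    c+t+d≋0 : c + t + d ≋ 0 [mod m ]
    c+t+d≋0 = begin c + t + d ≡⟨ solve (c ∷ d ∷ t ∷ []) ⟩ c + d + t ≈⟨ c+d+t≋0 ⟩ 0 ∎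
plusMinus-differBy⇔ {m} {t} {c} {d} {x} {y} (inj₂ (c+t≋0 , c+d≋t)) = mk⇔ to′ from′
  where
  open ≋-Reasoning m
  x≋x+[c+t] : x ≋ x + (c + t) [mod m ]
  x≋x+[c+t] = ≋-sym (≋-trans (+-cong-mod ≋-refl c+t≋0) (≋-reflexive (+-identityʳ x)))
  to′ : x ≋ y [mod m ] ⊎ x ≋ y + d [mod m ] → DifferBy m t y (x + c)
  to′ (inj₁ x≋y) = inj₂ (begin
    y            ≈⟨ x≋y ⟨
    x            ≈⟨ x≋x+[c+t] ⟩
    x + (c + t)  ≡⟨ +-assoc x c t ⟨
    x + c + t    ∎)
  to′ (inj₂ x≋y+d) = inj₁ (begin
    x + c        ≈⟨ +-cong-mod x≋y+d ≋-refl ⟩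
    y + d + c    ≡⟨ solve (y ∷ d ∷ c ∷ []) ⟩
    y + (c + d)  ≈⟨ +-cong-mod ≋-refl c+d≋t ⟩
    y + t        ∎)
  from′ : DifferBy m t y (x + c) → x ≋ y [mod m ] ⊎ x ≋ y + d [mod m ]
  from′ (inj₁ x+c≋y+t) = inj₂ (+-cancelʳ-mod c (begin
    x + c        ≈⟨ x+c≋y+t ⟩
    y + t        ≈⟨ +-cong-mod ≋-refl c+d≋t ⟨
    y + (c + d)  ≡⟨ solve (y ∷ d ∷ c ∷ []) ⟩
    y + d + c    ∎))
  from′ (inj₂ y≋x+c+t) = inj₁ (begin
    x            ≈⟨ x≋x+[c+t] ⟩
    x + (c + t)  ≡⟨ +-assoc x c t ⟨
    x + c + t    ≈⟨ y≋x+c+t ⟨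
    y            ∎)

circulant-adj⇔ : ∀ {m s₁ s₂} (x y : Fin m) →
  Adj (Circulant m ｛ s₁ , s₂ ｝) x y ⇔
  (DifferBy m s₁ (toℕ x) (toℕ y) ⊎ DifferBy m s₂ (toℕ x) (toℕ y))
circulant-adj⇔ x y = mk⇔
  (λ { (_ , inj₁ refl , d) → inj₁ (⊎-map ≡[mod]⇒≋ ≡[mod]⇒≋ d)
     ; (_ , inj₂ refl , d) → inj₂ (⊎-map ≡[mod]⇒≋ ≡[mod]⇒≋ d) })
  [ (λ d → _ , inj₁ refl , ⊎-map ≋⇒≡[mod] ≋⇒≡[mod] d)
  , (λ d → _ , inj₂ refl , ⊎-map ≋⇒≡[mod] ≋⇒≡[mod] d) ]′

module _ {n k : ℕ} where

  accordion-uu⇔ : ∀ (i j : Fin n) → Adj (Accordion n k) (inj₁ i) (inj₁ j) ⇔ DifferBy n 1 (toℕ i) (toℕ j)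
  accordion-uu⇔ i j = mk⇔
    (λ { (inj₁ (uu _ _ e)) → inj₁ (≡[mod]⇒≋ e) ; (inj₂ (uu _ _ e)) → inj₂ (≡[mod]⇒≋ e) })
    (λ { (inj₁ d) → inj₁ (uu i j (≋⇒≡[mod] d)) ; (inj₂ d) → inj₂ (uu j i (≋⇒≡[mod] d)) })

  accordion-vv⇔ : ∀ (i j : Fin n) → Adj (Accordion n k) (inj₂ i) (inj₂ j) ⇔ DifferBy n 1 (toℕ i) (toℕ j)
  accordion-vv⇔ i j = mk⇔
    (λ { (inj₁ (vv _ _ e)) → inj₁ (≡[mod]⇒≋ e) ; (inj₂ (vv _ _ e)) → inj₂ (≡[mod]⇒≋ e) })
    (λ { (inj₁ d) → inj₁ (vv i j (≋⇒≡[mod] d)) ; (inj₂ d) → inj₂ (vv j i (≋⇒≡[mod] d)) })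

  accordion-uv⇔ : ∀ (i j : Fin n) →
    Adj (Accordion n k) (inj₁ i) (inj₂ j) ⇔ (toℕ j ≋ toℕ i [mod n ] ⊎ toℕ j ≋ toℕ i + k [mod n ])
  accordion-uv⇔ i j = mk⇔
    (λ { (inj₁ (uv _ _ e)) → inj₁ (≡[mod]⇒≋ e)
       ; (inj₁ (uvk _ _ e)) → inj₂ (≡[mod]⇒≋ e)
       ; (inj₂ ()) })
    (λ { (inj₁ d) → inj₁ (uv i j (≋⇒≡[mod] d)) ; (inj₂ d) → inj₁ (uvk i j (≋⇒≡[mod] d)) })

  module _ (R : ℕ → ℕ → Set) (R-sym : ∀ {a b} → R a b → R b a) (ℓᵘ ℓᵛ : Fin n → ℕ)
    (uu⇔ : ∀ i j → DifferBy n 1 (toℕ i) (toℕ j) ⇔ R (ℓᵘ i) (ℓᵘ j))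
    (vv⇔ : ∀ i j → DifferBy n 1 (toℕ i) (toℕ j) ⇔ R (ℓᵛ i) (ℓᵛ j))
    (uv⇔ : ∀ i j → (toℕ j ≋ toℕ i [mod n ] ⊎ toℕ j ≋ toℕ i + k [mod n ]) ⇔ R (ℓᵘ i) (ℓᵛ j))
    where

    accordion-adj⇔ : ∀ x y → Adj (Accordion n k) x y ⇔ R ([ ℓᵘ , ℓᵛ ]′ x) ([ ℓᵘ , ℓᵛ ]′ y)
    accordion-adj⇔ (inj₁ i) (inj₁ j) = uu⇔ i j ⇔-∘ accordion-uu⇔ i j
    accordion-adj⇔ (inj₂ i) (inj₂ j) = vv⇔ i j ⇔-∘ accordion-vv⇔ i j
    accordion-adj⇔ (inj₁ i) (inj₂ j) = uv⇔ i j ⇔-∘ accordion-uv⇔ i j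
    accordion-adj⇔ (inj₂ j) (inj₁ i) = mk⇔
      (R-sym ∘ to (accordion-adj⇔ (inj₁ i) (inj₂ j)) ∘ swap)
      (swap ∘ from (accordion-adj⇔ (inj₁ i) (inj₂ j)) ∘ R-sym)

≅-from-labelling : ∀ {G H : Graph} (m : ℕ) (R : ℕ → ℕ → Set) →
  (∀ {a a′ b b′} → a ≋ a′ [mod m ] → b ≋ b′ [mod m ] → R a b → R a′ b′) →
  (ℓ : V G → ℕ) (pos : V H → ℕ) (F : V G ↔ V H) →
  (∀ x → pos (Inverse.to F x) ≋ ℓ x [mod m ]) →
  (∀ x y → Adj G x y ⇔ R (ℓ x) (ℓ y)) →
  (∀ a b → Adj H a b ⇔ R (pos a) (pos b)) →
  G ≅ H
≅-from-labelling m R R-resp ℓ pos F F≋ℓ G⇔ H⇔ = record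
  { bij       = ↔⇒⤖ F
  ; preserves = λ x y → from (H⇔ _ _) ∘ R-resp (≋-sym (F≋ℓ x)) (≋-sym (F≋ℓ y)) ∘ to (G⇔ x y)
  ; reflects  = λ x y → from (G⇔ x y) ∘ R-resp (F≋ℓ x) (F≋ℓ y) ∘ to (H⇔ _ _)
  }

module _ {m : ℕ} where

  rot : ℕ → Fin (suc m) → Fin (suc m)
  rot h j = (toℕ j + h) mod suc m

  toℕ-rot : ∀ h j → toℕ (rot h j) ≋ toℕ j + h [mod suc m ]
  toℕ-rot h j = ≋-trans (≋-reflexive (toℕ-fromℕ< (m%n<n (toℕ j + h) (suc m)))) (%-≋ (toℕ j + h))

  rot-inverse : ∀ {h h′} → h + h′ ≋ 0 [mod suc m ] → ∀ j → rot h′ (rot h j) ≡ j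
  rot-inverse {h} {h′} h+h′≋0 j = toℕ-injective (≋-<⇒≡ rot-rot≋j (toℕ<n _) (toℕ<n j))
    where
    open ≋-Reasoning (suc m)
    rot-rot≋j : toℕ (rot h′ (rot h j)) ≋ toℕ j [mod suc m ]
    rot-rot≋j = begin
      toℕ (rot h′ (rot h j))  ≈⟨ toℕ-rot h′ (rot h j) ⟩
      toℕ (rot h j) + h′      ≈⟨ +-cong-mod (toℕ-rot h j) ≋-refl ⟩
      toℕ j + h + h′          ≡⟨ +-assoc (toℕ j) h h′ ⟩
      toℕ j + (h + h′)        ≈⟨ +-cong-mod ≋-refl h+h′≋0 ⟩
      toℕ j + 0               ≡⟨ +-identityʳ (toℕ j) ⟩
      toℕ j                   ∎

  -- Rotation by h is undone by rotation by m * h, as h + m * h = (1 + m) * h.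
  rotate : ℕ → Fin (suc m) ↔ Fin (suc m)
  rotate h = mk↔ₛ′ (rot h) (rot (m * h)) (rot-inverse mh+h≋0) (rot-inverse h+mh≋0)
    where
    h+mh≋0 : h + m * h ≋ 0 [mod suc m ]
    h+mh≋0 = multiple⇒≋0 h (*-comm (suc m) h)
    mh+h≋0 : m * h + h ≋ 0 [mod suc m ]
    mh+h≋0 = ≋-trans (≋-reflexive (+-comm (m * h) h)) h+mh≋0

⊎↔×Fin2 : ∀ {a} {A : Set a} → (A ⊎ A) ↔ (A × Fin 2)
⊎↔×Fin2 = mk↔ₛ′
  [ (_, 0F) , (_, 1F) ]′
  (λ { (x , 0F) → inj₁ x ; (x , 1F) → inj₂ x ; (_ , Fin.suc (Fin.suc ())) })
  (λ { (x , 0F) → refl ; (x , 1F) → refl ; (_ , Fin.suc (Fin.suc ())) })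
  (λ { (inj₁ x) → refl ; (inj₂ x) → refl })

module _ {n : ℕ} where

  interleave : (Fin n ⊎ Fin n) ↔ Fin (2 * n)
  interleave = cast-id (*-comm n 2) ↔-∘ (↔-sym *↔× ↔-∘ ⊎↔×Fin2)

  toℕ-interleave-inj₁ : ∀ i → toℕ (Inverse.to interleave (inj₁ i)) ≡ 2 * toℕ i
  toℕ-interleave-inj₁ i = trans (toℕ-cast (*-comm n 2) _) (trans (toℕ-combine i 0F) (+-identityʳ _))

  toℕ-interleave-inj₂ : ∀ j → toℕ (Inverse.to interleave (inj₂ j)) ≡ 2 * toℕ j + 1
  toℕ-interleave-inj₂ j = trans (toℕ-cast (*-comm n 2) _) (toℕ-combine j 1F)

  stack : (Fin n ⊎ Fin n) ↔ Fin (2 * n)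
  stack = cast-id (cong (n +_) (sym (+-identityʳ n))) ↔-∘ ↔-sym +↔⊎

  toℕ-stack-inj₁ : ∀ i → toℕ (Inverse.to stack (inj₁ i)) ≡ toℕ i
  toℕ-stack-inj₁ i = trans (toℕ-cast _ _) (toℕ-↑ˡ i n)

  toℕ-stack-inj₂ : ∀ j → toℕ (Inverse.to stack (inj₂ j)) ≡ n + toℕ j
  toℕ-stack-inj₂ j = trans (toℕ-cast _ _) (toℕ-↑ʳ n j)

module _ {m : ℕ} where

  m+1≋0 : m + 1 ≋ 0 [mod suc m ]
  m+1≋0 = multiple⇒≋0 1 (trans (+-comm m 1) (sym (*-identityˡ (suc m))))

  -- As 1 + n ≡ −(n − 1) (mod 2n), the steps ±1 and ±(n − 1) modulo 2n are exactly the steps ±1 modulo n.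
  circulant-1-pred-adj⇔ : ∀ (x y : Fin (2 * suc m)) →
    Adj (Circulant (2 * suc m) ｛ 1 , m ｝) x y ⇔ DifferBy (suc m) 1 (toℕ x) (toℕ y)
  circulant-1-pred-adj⇔ x y = differBy-1-or-pred⇔ ⇔-∘ circulant-adj⇔ x y
    where
    n : ℕ
    n = suc m
    1+n+m≋0 : 1 + n + m ≋ 0 [mod 2 * n ]
    1+n+m≋0 = multiple⇒≋0 1 (sum-eq m)
      where
      sum-eq : ∀ m → 1 + suc m + m ≡ 1 * (2 * suc m)
      sum-eq = solve-∀
    lift : ∀ {a b} → b ≋ a + 1 [mod n ] → b ≋ a + 1 [mod 2 * n ] ⊎ a ≋ b + m [mod 2 * n ]
    lift {a} b≋a+1 with mod⇒mod-2* b≋a+1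
    ... | inj₁ b≋a+1′ = inj₁ b≋a+1′
    ... | inj₂ b≋a+1+n = inj₂ (shift-opposite 1+n+m≋0 (≋-trans b≋a+1+n (≋-reflexive (+-assoc a 1 n))))
    differBy-1-or-pred⇔ : ∀ {a b} → (DifferBy (2 * n) 1 a b ⊎ DifferBy (2 * n) m a b) ⇔ DifferBy n 1 a b
    differBy-1-or-pred⇔ = mk⇔
      (λ { (inj₁ d) → ⊎-map mod-2*⇒mod mod-2*⇒mod d
         ; (inj₂ (inj₁ b≋a+m)) → inj₂ (shift-opposite m+1≋0 (mod-2*⇒mod b≋a+m))
         ; (inj₂ (inj₂ a≋b+m)) → inj₁ (shift-opposite m+1≋0 (mod-2*⇒mod a≋b+m)) })
      (λ { (inj₁ b≋a+1) → ⊎-map inj₁ inj₂ (lift b≋a+1)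
         ; (inj₂ a≋b+1) → ⊎-map inj₂ inj₁ (lift a≋b+1) })

  accordion≅circulant-1-pred : Accordion (suc m) 2 ≅ Circulant (2 * suc m) ｛ 1 , m ｝
  accordion≅circulant-1-pred = ≅-from-labelling n (DifferBy n 1) differBy-resp [ ℓᵘ , ℓᵛ ]′ toℕ F F≋ℓ
    (accordion-adj⇔ (DifferBy n 1) differBy-sym ℓᵘ ℓᵛ
      (λ _ _ → ⇔-id _)
      (λ _ _ → ⇔-sym (differBy-+ʳ⇔ m))
      (λ _ _ → plusMinus-differBy⇔ (inj₂ (m+1≋0 , m+2≋1))))
    circulant-1-pred-adj⇔
    where
    n : ℕ
    n = suc m
    open ≋-Reasoning n
    ℓᵘ ℓᵛ : Fin n → ℕ
    ℓᵘ i = toℕ i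
    ℓᵛ j = toℕ j + m
    F : (Fin n ⊎ Fin n) ↔ Fin (2 * n)
    F = stack ↔-∘ (↔-id _ ⊎-↔ rotate m)
    F≋ℓ : ∀ x → toℕ (Inverse.to F x) ≋ [ ℓᵘ , ℓᵛ ]′ x [mod n ]
    F≋ℓ (inj₁ i) = ≋-reflexive (toℕ-stack-inj₁ i)
    F≋ℓ (inj₂ j) = begin
      toℕ (Inverse.to stack (inj₂ (rot m j)))  ≡⟨ toℕ-stack-inj₂ (rot m j) ⟩
      n + toℕ (rot m j)                        ≈⟨ +-cong-mod modulus≋0 ≋-refl ⟩
      toℕ (rot m j)                            ≈⟨ toℕ-rot m j ⟩
      toℕ j + m                                ∎
    m+2≋1 : m + 2 ≋ 1 [mod n ]
    m+2≋1 = begin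
      m + 2      ≡⟨ +-assoc m 1 1 ⟨
      m + 1 + 1  ≈⟨ +-cong-mod m+1≋0 ≋-refl ⟩
      1          ∎
  accordion≅circulant-odd : ∀ {k c t} → Odd c → Odd t → PlusMinusPair (2 * suc m) t c (2 * k) →
    Accordion (suc m) k ≅ Circulant (2 * suc m) ｛ 2 , t ｝
  accordion≅circulant-odd {k} {c} {t} c-odd@(h , c≡1+2h) t-odd ± =
    ≅-from-labelling (2 * n) R R-resp [ ℓᵘ , ℓᵛ ]′ toℕ F F≋ℓ
      (accordion-adj⇔ R R-sym ℓᵘ ℓᵛ (λ _ _ → differBy-1⇔doubled-steps t-odd) vv⇔ uv⇔)
      circulant-adj⇔
    where
    n : ℕ
    n = suc m
    open ≋-Reasoning (2 * n)
    R : ℕ → ℕ → Set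
    R a b = DifferBy (2 * n) 2 a b ⊎ DifferBy (2 * n) t a b
    R-resp : ∀ {a a′ b b′} → a ≋ a′ [mod 2 * n ] → b ≋ b′ [mod 2 * n ] → R a b → R a′ b′
    R-resp a≋a′ b≋b′ = ⊎-map (differBy-resp a≋a′ b≋b′) (differBy-resp a≋a′ b≋b′)
    R-sym : ∀ {a b} → R a b → R b a
    R-sym = ⊎-map differBy-sym differBy-sym
    ℓᵘ ℓᵛ : Fin n → ℕ
    ℓᵘ i = 2 * toℕ i
    ℓᵛ j = 2 * toℕ j + c
    F : (Fin n ⊎ Fin n) ↔ Fin (2 * n)
    F = interleave ↔-∘ (↔-id _ ⊎-↔ rotate h)
    F≋ℓ : ∀ x → toℕ (Inverse.to F x) ≋ [ ℓᵘ , ℓᵛ ]′ x [mod 2 * n ]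
    F≋ℓ (inj₁ i) = ≋-reflexive (toℕ-interleave-inj₁ i)
    F≋ℓ (inj₂ j) = begin
      toℕ (Inverse.to interleave (inj₂ (rot h j)))  ≡⟨ toℕ-interleave-inj₂ (rot h j) ⟩
      2 * toℕ (rot h j) + 1                         ≈⟨ +-cong-mod (to double⇔ (toℕ-rot h j)) ≋-refl ⟩
      2 * (toℕ j + h) + 1                           ≡⟨ regroup (toℕ j) h ⟩
      2 * toℕ j + (1 + 2 * h)                       ≡⟨ cong (2 * toℕ j +_) c≡1+2h ⟨
      2 * toℕ j + c                                 ∎
      where
      regroup : ∀ x h → 2 * (x + h) + 1 ≡ 2 * x + (1 + 2 * h)
      regroup = solve-∀
    vv⇔ : ∀ i j → DifferBy n 1 (toℕ i) (toℕ j) ⇔ R (ℓᵛ i) (ℓᵛ j)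
    vv⇔ i j = ⇔-sym (differBy-+ʳ⇔ c ⊎-⇔ differBy-+ʳ⇔ c) ⇔-∘ differBy-1⇔doubled-steps t-odd
    uv⇔ : ∀ i j → (toℕ j ≋ toℕ i [mod n ] ⊎ toℕ j ≋ toℕ i + k [mod n ]) ⇔ R (ℓᵘ i) (ℓᵛ j)
    uv⇔ i j = only-odd-steps ⇔-∘ (plusMinus-differBy⇔ ± ⇔-∘ (double⇔ ⊎-⇔ double+⇔ k))
      where
      only-odd-steps : DifferBy (2 * n) t (ℓᵘ i) (ℓᵛ j) ⇔ R (ℓᵘ i) (ℓᵛ j)
      only-odd-steps =
        mk⇔ inj₂ [ ⊥-elim ∘ ¬differBy-2-even-odd {n} {c} {toℕ i} {toℕ j} c-odd , (λ d → d) ]′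

  -- c = 2n(p + 1) − k is the odd representative of −k.
  accordion≅circulant-odd-k : ∀ {k} → Odd k → Accordion (suc m) k ≅ Circulant (2 * suc m) ｛ 2 , k ｝
  accordion≅circulant-odd-k k-odd@(p , refl) =
    accordion≅circulant-odd (m * (p + 1) , refl) k-odd (inj₂ (c+k≋0 , c+2k≋k))
    where
    open ≋-Reasoning (2 * suc m)
    c : ℕ
    c = 1 + 2 * (m * (p + 1))
    c+k≡[p+1]*2n : ∀ m p → 1 + 2 * (m * (p + 1)) + (1 + 2 * p) ≡ (p + 1) * (2 * suc m)
    c+k≡[p+1]*2n = solve-∀
    c+k≋0 : c + (1 + 2 * p) ≋ 0 [mod 2 * suc m ]
    c+k≋0 = multiple⇒≋0 (p + 1) (c+k≡[p+1]*2n m p)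
    c+2k≡c+k+k : ∀ c k → c + 2 * k ≡ c + k + k
    c+2k≡c+k+k = solve-∀
    c+2k≋k : c + 2 * (1 + 2 * p) ≋ 1 + 2 * p [mod 2 * suc m ]
    c+2k≋k = begin
      c + 2 * (1 + 2 * p)          ≡⟨ c+2k≡c+k+k c (1 + 2 * p) ⟩
      c + (1 + 2 * p) + (1 + 2 * p)  ≈⟨ +-cong-mod c+k≋0 ≋-refl ⟩
      1 + 2 * p                    ∎

  accordion≅circulant-n∸k : ∀ {k} → Odd (suc m) → Even k → k ≤ suc m →
    Accordion (suc m) k ≅ Circulant (2 * suc m) ｛ 2 , suc m ∸ k ｝
  accordion≅circulant-n∸k {k} n-odd k-even k≤n =
    accordion≅circulant-odd t-odd t-odd (inj₁ (≋-refl , multiple⇒≋0 1 t+2k+t≡2n))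
    where
    open ≡-Reasoning
    t : ℕ
    t = suc m ∸ k
    t-odd : Odd t
    t-odd = odd∸even n-odd k-even k≤n
    t+2k+t≡2[t+k] : ∀ t k → t + 2 * k + t ≡ 2 * (t + k)
    t+2k+t≡2[t+k] = solve-∀
    t+2k+t≡2n : t + 2 * k + t ≡ 1 * (2 * suc m)
    t+2k+t≡2n = begin
      t + 2 * k + t    ≡⟨ t+2k+t≡2[t+k] t k ⟩
      2 * (t + k)      ≡⟨ cong (2 *_) (m∸n+n≡m k≤n) ⟩
      2 * suc m        ≡⟨ *-identityˡ (2 * suc m) ⟨
      1 * (2 * suc m)  ∎

corollary5p6 : (n k : ℕ) → 3 ≤ n → 0 < k → 2 * k ≤ n →
    (Odd k → Accordion n k ≅ Circulant (2 * n) ｛ 2 , k ｝)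
  × (Odd n → Even k → Accordion n k ≅ Circulant (2 * n) ｛ 2 , n ∸ k ｝)
  × (Even n → k ≡ 2 → Accordion n k ≅ Circulant (2 * n) ｛ 1 , n ∸ 1 ｝)
corollary5p6 zero _ () _ _
corollary5p6 (suc m) k _ _ 2k≤n =
    accordion≅circulant-odd-k
  , (λ n-odd k-even → accordion≅circulant-n∸k n-odd k-even (≤-trans (m≤m+n k (k + 0)) 2k≤n))
  , λ { _ refl → accordion≅circulant-1-pred }
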